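{- For every $u\in V$, the degree $\delta_G(u)$ of $u$ in $G$ satisfies $\mathbb{E}[\delta_G(u)]\le 6$.
   Context: Let $n\ge 3$ be an integer and $[\![n]\!]=\{0,1,\dots,n-1\}$. The torus $T=(V,E_T)$ has $V=[\![n]\!]^2$, with $(i,j)$ adjacent to $(i,(j+1)\bmod n)$ and $((i+1)\bmod n,j)$. For $u=(x_u,y_u),v=(x_v,y_v)$, $d_{uv}=\min(|x_u-x_v|,n-|x_u-x_v|)+\min(|y_u-y_v|,n-|y_u-y_v|)$. Let $Z=\left(\sum_{w\in V\setminus\{u\}} d_{uw}^{ -2}\right)^{ -1}$ (independent of $u$). The UTSW random graph $G=(V,E)$: independently for each $u\in V$, $u$ chooses one $v\in V\setminus\{u\}$ with probability $Z\,d_{uv}^{ -2}$, and $E=E_T\cup\{\{u,v\}:u\text{ chose }v\}$ without parallel edges. -}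

module Defs where

open import Data.Nat as ℕ using (ℕ; zero; suc; _⊓_; ∣_-_∣; _∸_; _%_)
open import Data.Fin using (Fin; toℕ)
open import Data.Fin.Properties using () renaming (_≟_ to _≟F_)
open import Data.Product using (_×_; _,_; proj₁; proj₂)
open import Data.Product.Properties using (≡-dec)
open import Data.Bool using (Bool; true; false; if_then_else_; _∨_; _∧_; not)
open import Data.List using (List; []; _∷_; map; concatMap; cartesianProduct; allFin; foldr; filterᵇ; length)
open import Data.Integer using (+_)
open import Data.Rational using (ℚ; 0ℚ; 1ℚ; _+_; _*_; 1/_; ≢-nonZero; _/_) renaming (_≟_ to _≟ℚ_)
open import Relation.Nullary using (yes; no; does)
open import Relation.Binary.PropositionalEquality using (_≡_; _≢_)

Vtx : ℕ → Set
Vtx n = Fin n × Fin n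

_≟V_ : ∀ {n} (u v : Vtx n) → Relation.Nullary.Dec (u ≡ v)
_≟V_ = ≡-dec _≟F_ _≟F_

allV : ∀ n → List (Vtx n)
allV n = cartesianProduct (allFin n) (allFin n)

cdist : ℕ → ℕ → ℕ → ℕ
cdist n a b = ∣ a - b ∣ ⊓ (n ∸ ∣ a - b ∣)

dist : ∀ {n} → Vtx n → Vtx n → ℕ
dist {n} (xu , yu) (xv , yv) = cdist n (toℕ xu) (toℕ xv) ℕ.+ cdist n (toℕ yu) (toℕ yv)

_==ℕ_ : ℕ → ℕ → Bool
a ==ℕ b = does (a ℕ.≟ b)

succMod : ℕ → ℕ → ℕ
succMod n a with n
... | zero = a
... | suc m = suc a % suc m

torusArc : ∀ {n} → Vtx n → Vtx n → Bool
torusArc {n} (i , j) (i' , j') =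
  ((toℕ i ==ℕ toℕ i') ∧ (toℕ j' ==ℕ succMod n (toℕ j)))
  ∨ ((toℕ j ==ℕ toℕ j') ∧ (toℕ i' ==ℕ succMod n (toℕ i)))

torusAdj : ∀ {n} → Vtx n → Vtx n → Bool
torusAdj u v = torusArc u v ∨ torusArc v u

sumℚ : List ℚ → ℚ
sumℚ = foldr _+_ 0ℚ

prodℚ : List ℚ → ℚ
prodℚ = foldr _*_ 1ℚ

-- 1 / k^2 (with value 0 at k = 0, only used for u = v where the weight is excluded)
invSq : ℕ → ℚ
invSq zero = 0ℚ
invSq (suc k) = ((+ 1) / suc k) * ((+ 1) / suc k)

-- total inverse on ℚ (value 0 at 0; never used at 0 since n ≥ 3)
recip : ℚ → ℚ
recip q with q ≟ℚ 0ℚ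
... | yes _ = 0ℚ
... | no q≢0 = 1/_ q {{≢-nonZero q≢0}}

Zc : ∀ n → Vtx n → ℚ
Zc n u = recip (sumℚ (map (λ w → if does (u ≟V w) then 0ℚ else invSq (dist u w)) (allV n)))

pChoose : ∀ n → Vtx n → Vtx n → ℚ
pChoose n u v = if does (u ≟V v) then 0ℚ else Zc n u * invSq (dist u v)

-- outcome of the random experiment: a choice function f : V → V (u chooses f u)
update : ∀ {n} → (Vtx n → Vtx n) → Vtx n → Vtx n → (Vtx n → Vtx n)
update g x c y = if does (y ≟V x) then c else g y

-- all functions on V (agreeing with `const d` outside the domain list)
allFuns : ∀ {n} → Vtx n → List (Vtx n) → List (Vtx n) → List (Vtx n → Vtx n)
allFuns d [] cs = (λ _ → d) ∷ []
allFuns d (x ∷ xs) cs = concatMap (λ g → map (update g x) cs) (allFuns d xs cs)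

probOutcome : ∀ n → (Vtx n → Vtx n) → ℚ
probOutcome n f = prodℚ (map (λ u → pChoose n u (f u)) (allV n))

edgeG : ∀ {n} → (Vtx n → Vtx n) → Vtx n → Vtx n → Bool
edgeG f u w = not (does (u ≟V w))
  ∧ (torusAdj u w ∨ does (f u ≟V w) ∨ does (f w ≟V u))

degG : ∀ n → (Vtx n → Vtx n) → Vtx n → ℕ
degG n f u = length (filterᵇ (edgeG f u) (allV n))

expDeg : ∀ n → Vtx n → ℚ
expDeg n u = sumℚ (map (λ f → probOutcome n f * ((+ degG n f u) / 1)) (allFuns u (allV n) (allV n)))

module Submission where

-- The degree of u is at most its 4 torus neighbours, plus the vertex u chose, plus the number of
-- vertices that chose u; by linearity the last term has expectation Σ_w P(w chooses u). The weights
-- d⁻² are invariant under translations of the torus, so the normaliser Z is the same at every vertex,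
-- and as d is symmetric every column sum Σ_w Z d_wu⁻² equals a row sum, i.e. 1. Hence E δ(u) ≤ 4 + 1 + 1.

open import Algebra.Bundles using (CommutativeMonoid)
import Algebra.Properties.CommutativeSemigroup as CommutativeSemigroupProperties
open import Data.Bool using (Bool; true; false; _∧_; _∨_; not; if_then_else_)
open import Data.Empty using (⊥-elim)
open import Data.Fin using (Fin; zero; suc; toℕ; fromℕ<; inject₁)
import Data.Fin as Fin
open import Data.Fin.Induction using (<-weakInduction)
open import Data.Fin.Properties using (toℕ-injective; toℕ<n; toℕ-fromℕ<; toℕ-inject₁; toℕ-fromℕ)
open import Data.Integer using (+_)
import Data.Integer as ℤ
import Data.Integer.Properties as ℤ
open import Data.List using (List; []; _∷_; map; _++_; concatMap; cartesianProduct; allFin; tabulate; filterᵇ; length)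
open import Data.List.Membership.Propositional using (_∈_)
open import Data.List.Membership.Propositional.Properties using (∈-cartesianProduct⁺; ∈-allFin)
open import Data.List.Properties using (map-tabulate; tabulate-cong)
open import Data.List.Relation.Unary.All as All using (All)
open import Data.List.Relation.Unary.AllPairs using (_∷_)
open import Data.List.Relation.Unary.Any using (here; there)
open import Data.List.Relation.Unary.Unique.Propositional using (Unique)
open import Data.List.Relation.Unary.Unique.Propositional.Properties using (cartesianProduct⁺; allFin⁺)
open import Data.Nat as ℕ using (ℕ; zero; suc; _≤_; s≤s; _⊓_; _∸_; ∣_-_∣)
open import Data.Nat.DivMod using (m%n<n; m<n⇒m%n≡m; n%n≡0)
import Data.Nat.Properties as ℕ
open import Data.Product using (_×_; _,_; proj₁; proj₂; swap)
open import Data.Rational using (ℚ; 0ℚ; 1ℚ; _+_; _*_; _/_; 1/_; toℚᵘ; nonNegative; positive; ≢-nonZero)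
  renaming (_≤_ to _≤ℚ_; _<_ to _<ℚ_; _≟_ to _≟ℚ_)
open import Data.Rational.Properties
import Data.Rational.Unnormalised as ℚᵘ
import Data.Rational.Unnormalised.Properties as ℚᵘ
open import Data.Sum using (inj₁; inj₂)
open import Data.Unit using (tt)
open import Function using (_∘_)
open import Relation.Binary.Definitions using (DecidableEquality)
open import Relation.Binary.PropositionalEquality
open import Relation.Nullary using (Dec; yes; no; does)
open import Relation.Nullary.Decidable using (dec-true; dec-false; toWitness)

open import Defs

open CommutativeSemigroupProperties (CommutativeMonoid.commutativeSemigroup +-0-commutativeMonoid)
  using () renaming (interchange to +-interchange)

variable
  A B : Set

∑ : List A → (A → ℚ) → ℚ
∑ xs f = sumℚ (map f xs)

∑-cong : ∀ xs {f g : A → ℚ} → (∀ {x} → x ∈ xs → f x ≡ g x) → ∑ xs f ≡ ∑ xs g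
∑-cong []       f≗g = refl
∑-cong (x ∷ xs) f≗g = cong₂ _+_ (f≗g (here refl)) (∑-cong xs (f≗g ∘ there))

∑-zero : (xs : List A) → ∑ xs (λ _ → 0ℚ) ≡ 0ℚ
∑-zero []       = refl
∑-zero (x ∷ xs) = cong (_+_ 0ℚ) (∑-zero xs)

∑-+ : ∀ xs (f g : A → ℚ) → ∑ xs (λ x → f x + g x) ≡ ∑ xs f + ∑ xs g
∑-+ []       f g = refl
∑-+ (x ∷ xs) f g = trans (cong (_+_ (f x + g x)) (∑-+ xs f g)) (+-interchange (f x) (g x) _ _)

*-∑ : ∀ c xs (f : A → ℚ) → c * ∑ xs f ≡ ∑ xs (λ x → c * f x)
*-∑ c []       f = *-zeroʳ c
*-∑ c (x ∷ xs) f = trans (*-distribˡ-+ c (f x) (∑ xs f)) (cong (_+_ (c * f x)) (*-∑ c xs f))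

∑-* : ∀ c xs (f : A → ℚ) → ∑ xs f * c ≡ ∑ xs (λ x → f x * c)
∑-* c xs f = trans (*-comm (∑ xs f) c) (trans (*-∑ c xs f) (∑-cong xs λ {x} _ → *-comm c (f x)))

∑-++ : ∀ xs ys (f : A → ℚ) → ∑ (xs ++ ys) f ≡ ∑ xs f + ∑ ys f
∑-++ []       ys f = sym (+-identityˡ _)
∑-++ (x ∷ xs) ys f = trans (cong (_+_ (f x)) (∑-++ xs ys f)) (sym (+-assoc (f x) _ _))

∑-mono-≤ : ∀ xs {f g : A → ℚ} → (∀ {x} → x ∈ xs → f x ≤ℚ g x) → ∑ xs f ≤ℚ ∑ xs g
∑-mono-≤ []       f≤g = ≤-refl
∑-mono-≤ (x ∷ xs) f≤g = +-mono-≤ (f≤g (here refl)) (∑-mono-≤ xs (f≤g ∘ there))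

∑-nonNeg : ∀ xs {f : A → ℚ} → (∀ {x} → x ∈ xs → 0ℚ ≤ℚ f x) → 0ℚ ≤ℚ ∑ xs f
∑-nonNeg xs {f} 0≤f = subst (_≤ℚ ∑ xs f) (∑-zero xs) (∑-mono-≤ xs 0≤f)

term≤∑ : ∀ {xs} {f : A → ℚ} → (∀ {x} → x ∈ xs → 0ℚ ≤ℚ f x) → ∀ {y} → y ∈ xs → f y ≤ℚ ∑ xs f
term≤∑ {xs = x ∷ xs} {f} 0≤f (here refl) = subst (_≤ℚ f x + ∑ xs f) (+-identityʳ (f x))
  (+-monoʳ-≤ (f x) (∑-nonNeg xs (0≤f ∘ there)))
term≤∑ {xs = x ∷ xs} {f} 0≤f (there y∈xs) = ≤-trans (term≤∑ (0≤f ∘ there) y∈xs)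
  (subst (_≤ℚ f x + ∑ xs f) (+-identityˡ (∑ xs f)) (+-monoˡ-≤ (∑ xs f) (0≤f (here refl))))

∑-map : ∀ xs (g : A → B) (f : B → ℚ) → ∑ (map g xs) f ≡ ∑ xs (f ∘ g)
∑-map []       g f = refl
∑-map (x ∷ xs) g f = cong (_+_ (f (g x))) (∑-map xs g f)

∑-concatMap : ∀ xs (k : A → List B) (f : B → ℚ) → ∑ (concatMap k xs) f ≡ ∑ xs (λ a → ∑ (k a) f)
∑-concatMap []       k f = refl
∑-concatMap (x ∷ xs) k f = trans (∑-++ (k x) (concatMap k xs) f) (cong (_+_ (∑ (k x) f)) (∑-concatMap xs k f))

∑-comm : ∀ xs ys (F : A → B → ℚ) → ∑ xs (λ a → ∑ ys (F a)) ≡ ∑ ys (λ b → ∑ xs (λ a → F a b))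
∑-comm []       ys F = sym (∑-zero ys)
∑-comm (x ∷ xs) ys F = trans (cong (_+_ (∑ ys (F x))) (∑-comm xs ys F)) (sym (∑-+ ys (F x) _))

∑-cartesianProduct : ∀ xs ys (f : A × B → ℚ) →
                     ∑ (cartesianProduct xs ys) f ≡ ∑ xs (λ a → ∑ ys (λ b → f (a , b)))
∑-cartesianProduct []       ys f = refl
∑-cartesianProduct (x ∷ xs) ys f = trans (∑-++ (map (x ,_) ys) (cartesianProduct xs ys) f)
  (cong₂ _+_ (∑-map ys (x ,_) f) (∑-cartesianProduct xs ys f))

*-nonNeg : ∀ {p q} → 0ℚ ≤ℚ p → 0ℚ ≤ℚ q → 0ℚ ≤ℚ p * q
*-nonNeg {p} {q} p≥0 q≥0 =
  nonNegative⁻¹ (p * q) {{nonNeg*nonNeg⇒nonNeg p {{nonNegative p≥0}} q {{nonNegative q≥0}}}}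

χ : Bool → ℚ
χ true  = 1ℚ
χ false = 0ℚ

χ-nonNeg : ∀ b → 0ℚ ≤ℚ χ b
χ-nonNeg true  = nonNegative⁻¹ 1ℚ
χ-nonNeg false = ≤-refl

χ-∨ : ∀ a b → χ (a ∨ b) ≤ℚ χ a + χ b
χ-∨ true  true  = toWitness {a? = 1ℚ ≤? 1ℚ + 1ℚ} tt
χ-∨ true  false = ≤-refl
χ-∨ false b     = ≤-reflexive (sym (+-identityˡ (χ b)))

χ-∧ : ∀ a b → χ (a ∧ b) ≤ℚ χ b
χ-∧ true  b = ≤-refl
χ-∧ false b = χ-nonNeg b

∑-χ-≟ : (_≟_ : DecidableEquality A) (q : A → ℚ) {u : A} {xs : List A} → Unique xs → u ∈ xs →
        ∑ xs (λ c → q c * χ (does (c ≟ u))) ≡ q u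
∑-χ-≟ _≟_ q {xs = x ∷ xs} (x∉xs ∷ xs!) (here refl) = begin
  q x * χ (does (x ≟ x)) + ∑ xs (λ c → q c * χ (does (c ≟ x)))
    ≡⟨ cong₂ _+_ (cong (λ b → q x * χ b) (dec-true (x ≟ x) refl))
                 (∑-cong xs (λ {c} c∈xs → cong (λ b → q c * χ b)
                   (dec-false (c ≟ x) (λ c≡x → All.lookup x∉xs c∈xs (sym c≡x))))) ⟩
  q x * 1ℚ + ∑ xs (λ c → q c * 0ℚ)
    ≡⟨ cong₂ _+_ (*-identityʳ (q x)) (trans (∑-cong xs (λ {c} _ → *-zeroʳ (q c))) (∑-zero xs)) ⟩
  q x + 0ℚ
    ≡⟨ +-identityʳ (q x) ⟩
  q x ∎
  where open ≡-Reasoning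
∑-χ-≟ _≟_ q {u} {x ∷ xs} (x∉xs ∷ xs!) (there u∈xs) = begin
  q x * χ (does (x ≟ u)) + ∑ xs (λ c → q c * χ (does (c ≟ u)))
    ≡⟨ cong₂ _+_ (cong (λ b → q x * χ b) (dec-false (x ≟ u) (λ x≡u → All.lookup x∉xs u∈xs x≡u)))
                 (∑-χ-≟ _≟_ q xs! u∈xs) ⟩
  q x * 0ℚ + q u
    ≡⟨ cong (_+ q u) (*-zeroʳ (q x)) ⟩
  0ℚ + q u
    ≡⟨ +-identityˡ (q u) ⟩
  q u ∎
  where open ≡-Reasoning

count : (A → Bool) → List A → ℚ
count p xs = ∑ xs (χ ∘ p)

fromℕ : ℕ → ℚ
fromℕ k = (+ k) / 1

fromℕ-suc : ∀ k → fromℕ (suc k) ≡ 1ℚ + fromℕ k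
fromℕ-suc k = toℚᵘ-injective (begin-equality
  toℚᵘ (fromℕ (suc k))         ≃⟨ toℚᵘ-fromℚᵘ (ℚᵘ.mkℚᵘ (+ suc k) 0) ⟩
  ℚᵘ.mkℚᵘ (+ suc k) 0
    ≃⟨ ℚᵘ.*≡* (cong (ℤ._* + 1) (trans (ℤ.pos-+ 1 k) (cong (ℤ._+_ (+ 1)) (sym (ℤ.*-identityʳ (+ k)))))) ⟩
  ℚᵘ.1ℚᵘ ℚᵘ.+ ℚᵘ.mkℚᵘ (+ k) 0  ≃⟨ ℚᵘ.+-congʳ ℚᵘ.1ℚᵘ (ℚᵘ.≃-sym (toℚᵘ-fromℚᵘ (ℚᵘ.mkℚᵘ (+ k) 0))) ⟩
  toℚᵘ 1ℚ ℚᵘ.+ toℚᵘ (fromℕ k)  ≃⟨ ℚᵘ.≃-sym (toℚᵘ-homo-+ 1ℚ (fromℕ k)) ⟩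
  toℚᵘ (1ℚ + fromℕ k)          ∎)
  where open ℚᵘ.≤-Reasoning

fromℕ-length-filterᵇ : ∀ (p : A → Bool) xs → fromℕ (length (filterᵇ p xs)) ≡ count p xs
fromℕ-length-filterᵇ p []       = refl
fromℕ-length-filterᵇ p (x ∷ xs) with p x
... | true  = trans (fromℕ-suc (length (filterᵇ p xs))) (cong (_+_ 1ℚ) (fromℕ-length-filterᵇ p xs))
... | false = trans (fromℕ-length-filterᵇ p xs) (sym (+-identityˡ _))

count-∨ : ∀ (p q : A → Bool) xs → count (λ x → p x ∨ q x) xs ≤ℚ count p xs + count q xs
count-∨ p q xs = ≤-trans (∑-mono-≤ xs (λ {x} _ → χ-∨ (p x) (q x))) (≤-reflexive (∑-+ xs (χ ∘ p) (χ ∘ q)))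

count-∧ : ∀ (p q : A → Bool) xs → count (λ x → p x ∧ q x) xs ≤ℚ count q xs
count-∧ p q xs = ∑-mono-≤ xs (λ {x} _ → χ-∧ (p x) (q x))

AtMostOne : (A → Bool) → Set _
AtMostOne p = ∀ {a b} → p a ≡ true → p b ≡ true → a ≡ b

count-none : ∀ (p : A → Bool) xs → (∀ {x} → x ∈ xs → p x ≡ false) → count p xs ≡ 0ℚ
count-none p xs none = trans (∑-cong xs (cong χ ∘ none)) (∑-zero xs)

count-atMostOne : ∀ {p : A → Bool} {xs} → Unique xs → AtMostOne p → count p xs ≤ℚ 1ℚ
count-atMostOne {xs = []} _ _ = nonNegative⁻¹ 1ℚ
count-atMostOne {p = p} {x ∷ xs} (x∉xs ∷ xs!) p≤1 with p x in px
... | false = ≤-trans (≤-reflexive (+-identityˡ _)) (count-atMostOne xs! p≤1)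
... | true  = ≤-reflexive (cong (_+_ 1ℚ) (count-none p xs others))
  where
  others : ∀ {y} → y ∈ xs → p y ≡ false
  others {y} y∈xs with p y in py
  ... | false = refl
  ... | true  = ⊥-elim (All.lookup x∉xs y∈xs (p≤1 px py))

module _ {n : ℕ} where

  update-self : ∀ (g : Vtx n → Vtx n) x c → update g x c x ≡ c
  update-self g x c = cong (λ b → if b then c else g x) (dec-true (x ≟V x) refl)

  update-other : ∀ (g : Vtx n → Vtx n) {x} c {y} → y ≢ x → update g x c y ≡ g y
  update-other g {x} c {y} y≢x = cong (λ b → if b then c else g y) (dec-false (y ≟V x) y≢x)

  weight : (Vtx n → Vtx n → ℚ) → List (Vtx n) → (Vtx n → Vtx n) → ℚ
  weight q xs f = prodℚ (map (λ x → q x (f x)) xs)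

  weight-nonNeg : ∀ {q} → (∀ x c → 0ℚ ≤ℚ q x c) → ∀ xs f → 0ℚ ≤ℚ weight q xs f
  weight-nonNeg q≥0 []       f = nonNegative⁻¹ 1ℚ
  weight-nonNeg q≥0 (x ∷ xs) f = *-nonNeg (q≥0 x (f x)) (weight-nonNeg q≥0 xs f)

  weight-update : ∀ q xs g {x} c → All (x ≢_) xs → weight q xs (update g x c) ≡ weight q xs g
  weight-update q []       g c All.[]            = refl
  weight-update q (y ∷ xs) g c (x≢y All.∷ x∉xs) =
    cong₂ _*_ (cong (q y) (update-other g c (x≢y ∘ sym))) (weight-update q xs g c x∉xs)

  weight-∷-update : ∀ q {xs} g x c → All (x ≢_) xs → weight q (x ∷ xs) (update g x c) ≡ q x c * weight q xs g
  weight-∷-update q {xs} g x c x∉xs = cong₂ _*_ (cong (q x) (update-self g x c)) (weight-update q xs g c x∉xs)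

  ∑-allFuns-∷ : ∀ d x xs cs (F : (Vtx n → Vtx n) → ℚ) →
                ∑ (allFuns d (x ∷ xs) cs) F ≡ ∑ (allFuns d xs cs) (λ g → ∑ cs (λ c → F (update g x c)))
  ∑-allFuns-∷ d x xs cs F = trans (∑-concatMap (allFuns d xs cs) _ F)
    (∑-cong (allFuns d xs cs) (λ {g} _ → ∑-map cs (update g x) F))

  RowStochastic : (Vtx n → Vtx n → ℚ) → List (Vtx n) → Set
  RowStochastic q cs = ∀ x → ∑ cs (q x) ≡ 1ℚ

  ∑-weight : ∀ {q cs} → RowStochastic q cs → ∀ d xs → Unique xs → ∑ (allFuns d xs cs) (weight q xs) ≡ 1ℚ
  ∑-weight q-rows d []       _                    = refl
  ∑-weight {q} {cs} q-rows d (x ∷ xs) (x∉xs ∷ xs!) = begin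
    ∑ (allFuns d (x ∷ xs) cs) (weight q (x ∷ xs))
      ≡⟨ ∑-allFuns-∷ d x xs cs (weight q (x ∷ xs)) ⟩
    ∑ Fs (λ g → ∑ cs (λ c → weight q (x ∷ xs) (update g x c)))
      ≡⟨ ∑-cong Fs (λ {g} _ → ∑-cong cs (λ {c} _ → weight-∷-update q g x c x∉xs)) ⟩
    ∑ Fs (λ g → ∑ cs (λ c → q x c * weight q xs g))
      ≡⟨ ∑-cong Fs (λ {g} _ → sym (∑-* (weight q xs g) cs (q x))) ⟩
    ∑ Fs (λ g → ∑ cs (q x) * weight q xs g)
      ≡⟨ ∑-cong Fs (λ {g} _ → trans (cong (_* weight q xs g) (q-rows x)) (*-identityˡ (weight q xs g))) ⟩
    ∑ Fs (weight q xs)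
      ≡⟨ ∑-weight q-rows d xs xs! ⟩
    1ℚ ∎
    where
    open ≡-Reasoning
    Fs : List (Vtx n → Vtx n)
    Fs = allFuns d xs cs

  ∑-weight-marginal : ∀ {q cs} → RowStochastic q cs → ∀ d (G : Vtx n → ℚ) {w} xs → Unique xs → w ∈ xs →
                      ∑ (allFuns d xs cs) (λ f → weight q xs f * G (f w)) ≡ ∑ cs (λ c → q w c * G c)
  ∑-weight-marginal {q} {cs} q-rows d G (x ∷ xs) (x∉xs ∷ xs!) (here refl) = begin
    ∑ (allFuns d (x ∷ xs) cs) (λ f → weight q (x ∷ xs) f * G (f x))
      ≡⟨ ∑-allFuns-∷ d x xs cs _ ⟩
    ∑ Fs (λ g → ∑ cs (λ c → weight q (x ∷ xs) (update g x c) * G (update g x c x)))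
      ≡⟨ ∑-cong Fs (λ {g} _ → ∑-cong cs (λ {c} _ →
           cong₂ _*_ (weight-∷-update q g x c x∉xs) (cong G (update-self g x c)))) ⟩
    ∑ Fs (λ g → ∑ cs (λ c → (q x c * weight q xs g) * G c))
      ≡⟨ ∑-cong Fs (λ {g} _ → ∑-cong cs (λ {c} _ → reorder (q x c) (weight q xs g) (G c))) ⟩
    ∑ Fs (λ g → ∑ cs (λ c → weight q xs g * (q x c * G c)))
      ≡⟨ ∑-cong Fs (λ {g} _ → sym (*-∑ (weight q xs g) cs _)) ⟩
    ∑ Fs (λ g → weight q xs g * ∑ cs (λ c → q x c * G c))
      ≡⟨ sym (∑-* _ Fs (weight q xs)) ⟩
    ∑ Fs (weight q xs) * ∑ cs (λ c → q x c * G c)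
      ≡⟨ cong (_* _) (∑-weight q-rows d xs xs!) ⟩
    1ℚ * ∑ cs (λ c → q x c * G c)
      ≡⟨ *-identityˡ _ ⟩
    ∑ cs (λ c → q x c * G c) ∎
    where
    open ≡-Reasoning
    Fs : List (Vtx n → Vtx n)
    Fs = allFuns d xs cs
    reorder : ∀ a b c → (a * b) * c ≡ b * (a * c)
    reorder a b c = trans (cong (_* c) (*-comm a b)) (*-assoc b a c)
  ∑-weight-marginal {q} {cs} q-rows d G {w} (x ∷ xs) (x∉xs ∷ xs!) (there w∈xs) = begin
    ∑ (allFuns d (x ∷ xs) cs) (λ f → weight q (x ∷ xs) f * G (f w))
      ≡⟨ ∑-allFuns-∷ d x xs cs _ ⟩
    ∑ Fs (λ g → ∑ cs (λ c → weight q (x ∷ xs) (update g x c) * G (update g x c w)))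
      ≡⟨ ∑-cong Fs (λ {g} _ → ∑-cong cs (λ {c} _ →
           cong₂ _*_ (weight-∷-update q g x c x∉xs) (cong G (update-other g c w≢x)))) ⟩
    ∑ Fs (λ g → ∑ cs (λ c → (q x c * weight q xs g) * G (g w)))
      ≡⟨ ∑-cong Fs (λ {g} _ → ∑-cong cs (λ {c} _ → *-assoc (q x c) _ _)) ⟩
    ∑ Fs (λ g → ∑ cs (λ c → q x c * (weight q xs g * G (g w))))
      ≡⟨ ∑-cong Fs (λ {g} _ → sym (∑-* _ cs (q x))) ⟩
    ∑ Fs (λ g → ∑ cs (q x) * (weight q xs g * G (g w)))
      ≡⟨ ∑-cong Fs (λ {g} _ → trans (cong (_* _) (q-rows x)) (*-identityˡ _)) ⟩
    ∑ Fs (λ g → weight q xs g * G (g w))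
      ≡⟨ ∑-weight-marginal q-rows d G xs xs! w∈xs ⟩
    ∑ cs (λ c → q w c * G c) ∎
    where
    open ≡-Reasoning
    Fs : List (Vtx n → Vtx n)
    Fs = allFuns d xs cs
    w≢x : w ≢ x
    w≢x w≡x = All.lookup x∉xs w∈xs (sym w≡x)

does-true⇒ : ∀ {P : Set} (P? : Dec P) → does P? ≡ true → P
does-true⇒ (yes p) _  = p
does-true⇒ (no _)  ()

succMod-< : ∀ {m a} → a ℕ.< m → succMod (suc m) a ≡ suc a
succMod-< a<m = m<n⇒m%n≡m (s≤s a<m)

succMod-last : ∀ m → succMod (suc m) m ≡ 0
succMod-last m = n%n≡0 (suc m)

succMod-injective : ∀ {m a b} → a ℕ.< suc m → b ℕ.< suc m → succMod (suc m) a ≡ succMod (suc m) b → a ≡ b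
succMod-injective {m} {a} {b} a<n b<n eq with ℕ.m<1+n⇒m<n∨m≡n a<n | ℕ.m<1+n⇒m<n∨m≡n b<n
... | inj₁ a<m  | inj₁ b<m  = ℕ.suc-injective (trans (sym (succMod-< a<m)) (trans eq (succMod-< b<m)))
... | inj₁ a<m  | inj₂ refl = ⊥-elim (ℕ.1+n≢0 (trans (sym (succMod-< a<m)) (trans eq (succMod-last m))))
... | inj₂ refl | inj₁ b<m  = ⊥-elim (ℕ.1+n≢0 (trans (sym (succMod-< b<m)) (trans (sym eq) (succMod-last m))))
... | inj₂ refl | inj₂ refl = refl

-- torusArc u w is definitionally  torusStep u w ∨ torusStep (swap u) (swap w).
torusStep : ∀ {n} → Vtx n → Vtx n → Bool
torusStep {n} (i , j) (i′ , j′) = (toℕ i ==ℕ toℕ i′) ∧ (toℕ j′ ==ℕ succMod n (toℕ j))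

torusStep-sound : ∀ {n} (u w : Vtx n) → torusStep u w ≡ true →
                  proj₁ u ≡ proj₁ w × toℕ (proj₂ w) ≡ succMod n (toℕ (proj₂ u))
torusStep-sound {n} (i , j) (i′ , j′) e
  with toℕ i ==ℕ toℕ i′ in i≡i′ | toℕ j′ ==ℕ succMod n (toℕ j) in j′≡j+1 | e
... | true | true | _ = toℕ-injective (does-true⇒ (toℕ i ℕ.≟ toℕ i′) i≡i′) , does-true⇒ (toℕ j′ ℕ.≟ _) j′≡j+1

torusStep-from-atMostOne : ∀ {n} (u : Vtx n) → AtMostOne (torusStep u)
torusStep-from-atMostOne u {a} {b} ua ub with torusStep-sound u a ua | torusStep-sound u b ub
... | i≡a₁ , a₂≡j+1 | i≡b₁ , b₂≡j+1 =
  cong₂ _,_ (trans (sym i≡a₁) i≡b₁) (toℕ-injective (trans a₂≡j+1 (sym b₂≡j+1)))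

torusStep-to-atMostOne : ∀ {m} (u : Vtx (suc m)) → AtMostOne (λ w → torusStep w u)
torusStep-to-atMostOne u {a} {b} au bu with torusStep-sound a u au | torusStep-sound b u bu
... | a₁≡i , j≡a₂+1 | b₁≡i , j≡b₂+1 = cong₂ _,_ (trans a₁≡i (sym b₁≡i))
  (toℕ-injective (succMod-injective (toℕ<n (proj₂ a)) (toℕ<n (proj₂ b)) (trans (sym j≡a₂+1) j≡b₂+1)))

atMostOne-∘-swap : ∀ {p : A × B → Bool} → AtMostOne p → AtMostOne (p ∘ swap)
atMostOne-∘-swap p≤1 pa pb = cong swap (p≤1 pa pb)

count-∨-atMostOne : ∀ {p q : A → Bool} {xs} → Unique xs → AtMostOne p → AtMostOne q →
                    count (λ x → p x ∨ q x) xs ≤ℚ 1ℚ + 1ℚ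
count-∨-atMostOne {p = p} {q} {xs} xs! p≤1 q≤1 =
  ≤-trans (count-∨ p q xs) (+-mono-≤ (count-atMostOne xs! p≤1) (count-atMostOne xs! q≤1))

allV-unique : ∀ n → Unique (allV n)
allV-unique n = cartesianProduct⁺ (allFin⁺ n) (allFin⁺ n)

∈-allV : ∀ {n} (v : Vtx n) → v ∈ allV n
∈-allV (a , b) = ∈-cartesianProduct⁺ (∈-allFin a) (∈-allFin b)

degree≤ : ∀ {m} (f : Vtx (suc m) → Vtx (suc m)) u →
          fromℕ (degG (suc m) f u) ≤ℚ fromℕ 5 + count (λ w → does (f w ≟V u)) (allV (suc m))
degree≤ {m} f u = begin
  fromℕ (degG (suc m) f u)
    ≡⟨ fromℕ-length-filterᵇ (edgeG f u) V ⟩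
  count (edgeG f u) V
    ≤⟨ count-∧ (λ w → not (does (u ≟V w))) (λ w → torusAdj u w ∨ (chosen w ∨ chooser w)) V ⟩
  count (λ w → torusAdj u w ∨ (chosen w ∨ chooser w)) V
    ≤⟨ count-∨ (torusAdj u) (λ w → chosen w ∨ chooser w) V ⟩
  count (torusAdj u) V + count (λ w → chosen w ∨ chooser w) V
    ≤⟨ +-mono-≤ (≤-trans (count-∨ (torusArc u) (λ w → torusArc w u) V) (+-mono-≤ arcs-from arcs-to))
                (count-∨ chosen chooser V) ⟩
  four + (count chosen V + count chooser V)
    ≤⟨ +-monoʳ-≤ four (+-monoˡ-≤ (count chooser V) (count-atMostOne (allV-unique _) chosen-atMostOne)) ⟩
  four + (1ℚ + count chooser V)
    ≡⟨ sym (+-assoc four 1ℚ (count chooser V)) ⟩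
  fromℕ 5 + count chooser V ∎
  where
  open ≤-Reasoning
  V : List (Vtx (suc m))
  V = allV (suc m)
  four : ℚ
  four = (1ℚ + 1ℚ) + (1ℚ + 1ℚ)
  chosen chooser : Vtx (suc m) → Bool
  chosen w = does (f u ≟V w)
  chooser w = does (f w ≟V u)
  chosen-atMostOne : AtMostOne chosen
  chosen-atMostOne {a} {b} fu≡a fu≡b = trans (sym (does-true⇒ (f u ≟V a) fu≡a)) (does-true⇒ (f u ≟V b) fu≡b)
  arcs-from : count (torusArc u) V ≤ℚ 1ℚ + 1ℚ
  arcs-from = count-∨-atMostOne (allV-unique _)
    (torusStep-from-atMostOne u) (atMostOne-∘-swap (torusStep-from-atMostOne (swap u)))
  arcs-to : count (λ w → torusArc w u) V ≤ℚ 1ℚ + 1ℚ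
  arcs-to = count-∨-atMostOne (allV-unique _)
    (torusStep-to-atMostOne u) (atMostOne-∘-swap (torusStep-to-atMostOne (swap u)))

cdist-self : ∀ n a → cdist n a a ≡ 0
cdist-self n a = cong (λ d → d ⊓ (n ∸ d)) (ℕ.m≡n⇒∣m-n∣≡0 {a} refl)

cdist-comm : ∀ n a b → cdist n a b ≡ cdist n b a
cdist-comm n a b = cong (λ d → d ⊓ (n ∸ d)) (ℕ.∣-∣-comm a b)

dist-self : ∀ {n} (u : Vtx n) → dist u u ≡ 0
dist-self {n} (x , y) = cong₂ ℕ._+_ (cdist-self n (toℕ x)) (cdist-self n (toℕ y))

dist-comm : ∀ {n} (u w : Vtx n) → dist u w ≡ dist w u
dist-comm {n} (x , y) (x′ , y′) = cong₂ ℕ._+_ (cdist-comm n (toℕ x) (toℕ x′)) (cdist-comm n (toℕ y) (toℕ y′))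

⊓-∸-complement : ∀ {n d} → d ℕ.≤ n → (n ∸ d) ⊓ (n ∸ (n ∸ d)) ≡ d ⊓ (n ∸ d)
⊓-∸-complement {n} {d} d≤n = trans (cong ((n ∸ d) ⊓_) (ℕ.m∸[m∸n]≡n d≤n)) (ℕ.⊓-comm (n ∸ d) d)

cdist-last : ∀ {m b} → b ℕ.< m → cdist (suc m) m b ≡ cdist (suc m) 0 (suc b)
cdist-last {m} {b} b<m = trans (cong (λ d → d ⊓ (suc m ∸ d)) ∣m-b∣≡m∸b) (⊓-∸-complement (s≤s (ℕ.<⇒≤ b<m)))
  where
  ∣m-b∣≡m∸b : ∣ m - b ∣ ≡ m ∸ b
  ∣m-b∣≡m∸b = trans (ℕ.∣-∣-comm m b) (ℕ.m≤n⇒∣m-n∣≡n∸m (ℕ.<⇒≤ b<m))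

cdist-succMod : ∀ {m a b} → a ℕ.< suc m → b ℕ.< suc m →
                cdist (suc m) (succMod (suc m) a) (succMod (suc m) b) ≡ cdist (suc m) a b
cdist-succMod {m} {a} {b} a<n b<n with ℕ.m<1+n⇒m<n∨m≡n a<n | ℕ.m<1+n⇒m<n∨m≡n b<n
... | inj₁ a<m  | inj₁ b<m  rewrite succMod-< a<m | succMod-< b<m = refl
... | inj₂ refl | inj₁ b<m  rewrite succMod-last m | succMod-< b<m = sym (cdist-last b<m)
... | inj₁ a<m  | inj₂ refl rewrite succMod-last m | succMod-< a<m =
  trans (cdist-comm (suc m) (suc a) 0) (trans (sym (cdist-last a<m)) (cdist-comm (suc m) m a))
... | inj₂ refl | inj₂ refl rewrite succMod-last m = trans (cdist-self (suc m) 0) (sym (cdist-self (suc m) m))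

rotate : ∀ {m} → Fin (suc m) → Fin (suc m)
rotate {m} a = fromℕ< (m%n<n (suc (toℕ a)) (suc m))

toℕ-rotate : ∀ {m} (a : Fin (suc m)) → toℕ (rotate a) ≡ succMod (suc m) (toℕ a)
toℕ-rotate {m} a = toℕ-fromℕ< (m%n<n (suc (toℕ a)) (suc m))

rotate-inject₁ : ∀ {m} (i : Fin m) → rotate (inject₁ i) ≡ suc i
rotate-inject₁ {m} i = toℕ-injective (trans (toℕ-rotate (inject₁ i))
  (trans (cong (succMod (suc m)) (toℕ-inject₁ i)) (succMod-< (toℕ<n i))))

rotate-last : ∀ m → rotate (Fin.fromℕ m) ≡ zero
rotate-last m = toℕ-injective (trans (toℕ-rotate (Fin.fromℕ m))
  (trans (cong (succMod (suc m)) (toℕ-fromℕ m)) (succMod-last m)))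

cdist-rotate : ∀ {m} (a b : Fin (suc m)) →
               cdist (suc m) (toℕ (rotate a)) (toℕ (rotate b)) ≡ cdist (suc m) (toℕ a) (toℕ b)
cdist-rotate a b rewrite toℕ-rotate a | toℕ-rotate b = cdist-succMod (toℕ<n a) (toℕ<n b)

∑-allFin : ∀ {k} (h : Fin k → ℚ) → ∑ (allFin k) h ≡ sumℚ (tabulate h)
∑-allFin h = cong sumℚ (map-tabulate (λ a → a) h)

sumℚ-tabulate-last : ∀ k (h : Fin (suc k) → ℚ) →
                     sumℚ (tabulate h) ≡ sumℚ (tabulate (h ∘ inject₁)) + h (Fin.fromℕ k)
sumℚ-tabulate-last zero    h = trans (+-identityʳ (h zero)) (sym (+-identityˡ (h zero)))
sumℚ-tabulate-last (suc k) h = trans (cong (_+_ (h zero)) (sumℚ-tabulate-last k (h ∘ suc)))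
  (sym (+-assoc (h zero) _ _))

∑-allFin-rotate : ∀ {m} (h : Fin (suc m) → ℚ) → ∑ (allFin (suc m)) (h ∘ rotate) ≡ ∑ (allFin (suc m)) h
∑-allFin-rotate {m} h = begin
  ∑ (allFin (suc m)) (h ∘ rotate)
    ≡⟨ ∑-allFin (h ∘ rotate) ⟩
  sumℚ (tabulate (h ∘ rotate))
    ≡⟨ sumℚ-tabulate-last m (h ∘ rotate) ⟩
  sumℚ (tabulate (h ∘ rotate ∘ inject₁)) + h (rotate (Fin.fromℕ m))
    ≡⟨ cong₂ _+_ (cong sumℚ (tabulate-cong (cong h ∘ rotate-inject₁))) (cong h (rotate-last m)) ⟩
  sumℚ (tabulate (h ∘ suc)) + h zero
    ≡⟨ +-comm (sumℚ (tabulate (h ∘ suc))) (h zero) ⟩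
  sumℚ (tabulate h)
    ≡⟨ sym (∑-allFin h) ⟩
  ∑ (allFin (suc m)) h ∎
  where open ≡-Reasoning

∑-cdist-translation : ∀ {m} (G : ℕ → ℚ) (x : Fin (suc m)) →
                      ∑ (allFin (suc m)) (λ a → G (cdist (suc m) (toℕ x) (toℕ a)))
                      ≡ ∑ (allFin (suc m)) (λ a → G (cdist (suc m) 0 (toℕ a)))
∑-cdist-translation {m} G = <-weakInduction (λ x → S x ≡ S zero) refl S-suc
  where
  S : Fin (suc m) → ℚ
  S x = ∑ (allFin (suc m)) (λ a → G (cdist (suc m) (toℕ x) (toℕ a)))
  S-suc : ∀ i → S (inject₁ i) ≡ S zero → S (suc i) ≡ S zero
  S-suc i ih = begin
    S (suc i)
      ≡⟨ sym (∑-allFin-rotate {m} (λ a → G (cdist (suc m) (toℕ (suc i)) (toℕ a)))) ⟩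
    ∑ (allFin (suc m)) (λ a → G (cdist (suc m) (toℕ (suc i)) (toℕ (rotate a))))
      ≡⟨ ∑-cong (allFin (suc m)) (λ {a} _ → cong G (trans
           (cong (λ r → cdist (suc m) (toℕ r) (toℕ (rotate a))) (sym (rotate-inject₁ i)))
           (cdist-rotate (inject₁ i) a))) ⟩
    S (inject₁ i)
      ≡⟨ ih ⟩
    S zero ∎
    where open ≡-Reasoning

invSq-nonNeg : ∀ d → 0ℚ ≤ℚ invSq d
invSq-nonNeg zero    = ≤-refl
invSq-nonNeg (suc d) = *-nonNeg 1/d≥0 1/d≥0
  where
  1/d≥0 : 0ℚ ≤ℚ (+ 1) / suc d
  1/d≥0 = nonNegative⁻¹ _ {{normalize-nonNeg 1 (suc d)}}

recip-*-self : ∀ q → 0ℚ <ℚ q → recip q * q ≡ 1ℚ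
recip-*-self q q>0 with q ≟ℚ 0ℚ
... | yes q≡0 = ⊥-elim (<-irrefl (sym q≡0) q>0)
... | no  q≢0 = *-inverseˡ q {{≢-nonZero q≢0}}

recip-nonNeg : ∀ q → 0ℚ <ℚ q → 0ℚ ≤ℚ recip q
recip-nonNeg q q>0 with q ≟ℚ 0ℚ
... | yes _   = ≤-refl
... | no  q≢0 = nonNegative⁻¹ 1/q {{pos⇒nonNeg 1/q {{1/pos⇒pos q {{positive q>0}}}}}}
  where
  1/q : ℚ
  1/q = (1/ q) {{≢-nonZero q≢0}}

invSqSum : ∀ {n} → Vtx n → ℚ
invSqSum {n} u = ∑ (allV n) (invSq ∘ dist u)

invSq-dist-masked : ∀ {n} (u w : Vtx n) → (if does (u ≟V w) then 0ℚ else invSq (dist u w)) ≡ invSq (dist u w)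
invSq-dist-masked u w with u ≟V w
... | yes refl = sym (cong invSq (dist-self u))
... | no  _    = refl

invSqSum-translation : ∀ {m} (u : Vtx (suc m)) → invSqSum u ≡ invSqSum {suc m} (zero , zero)
invSqSum-translation {m} (x , y) = begin
  ∑ (allV (suc m)) (invSq ∘ dist (x , y))
    ≡⟨ ∑-cartesianProduct I I (invSq ∘ dist (x , y)) ⟩
  ∑ I (λ a → ∑ I (λ b → invSq (cd x a ℕ.+ cd y b)))
    ≡⟨ ∑-cong I (λ {a} _ → ∑-cdist-translation (λ e → invSq (cd x a ℕ.+ e)) y) ⟩
  ∑ I (λ a → ∑ I (λ b → invSq (cd x a ℕ.+ cd zero b)))
    ≡⟨ ∑-cdist-translation (λ e → ∑ I (λ b → invSq (e ℕ.+ cd zero b))) x ⟩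
  ∑ I (λ a → ∑ I (λ b → invSq (cd zero a ℕ.+ cd zero b)))
    ≡⟨ sym (∑-cartesianProduct I I (invSq ∘ dist (zero , zero))) ⟩
  invSqSum {suc m} (zero , zero) ∎
  where
  open ≡-Reasoning
  I : List (Fin (suc m))
  I = allFin (suc m)
  cd : Fin (suc m) → Fin (suc m) → ℕ
  cd a b = cdist (suc m) (toℕ a) (toℕ b)

module _ {k : ℕ} where

  private
    n : ℕ
    n = suc (suc k)
    V : List (Vtx n)
    V = allV n
    Z : ℚ
    Z = recip (invSqSum {n} (zero , zero))

  invSqSum-pos : ∀ (u : Vtx n) → 0ℚ <ℚ invSqSum u
  invSqSum-pos u = subst (0ℚ <ℚ_) (sym (invSqSum-translation u))
    (<-≤-trans (positive⁻¹ 1ℚ) (term≤∑ {f = invSq ∘ dist {n} (zero , zero)}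
      (λ {w} _ → invSq-nonNeg (dist (zero , zero) w))
      -- the term at (0 , 1) computes to invSq 1 = 1ℚ; this is where n ≥ 2 is used
      (∈-allV (zero , suc zero))))

  Z-*-invSqSum : ∀ (u : Vtx n) → Z * invSqSum u ≡ 1ℚ
  Z-*-invSqSum u = trans (cong (Z *_) (invSqSum-translation u)) (recip-*-self _ (invSqSum-pos (zero , zero)))

  pChoose-invSq : ∀ (u v : Vtx n) → pChoose n u v ≡ Z * invSq (dist u v)
  pChoose-invSq u v with u ≟V v
  ... | yes refl = sym (trans (cong (λ d → Z * invSq d) (dist-self u)) (*-zeroʳ Z))
  ... | no  _    = cong (λ s → recip s * invSq (dist u v))
    (trans (∑-cong V (λ {w} _ → invSq-dist-masked u w)) (invSqSum-translation u))

  pChoose-nonNeg : ∀ (u v : Vtx n) → 0ℚ ≤ℚ pChoose n u v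
  pChoose-nonNeg u v = subst (0ℚ ≤ℚ_) (sym (pChoose-invSq u v))
    (*-nonNeg (recip-nonNeg _ (invSqSum-pos (zero , zero))) (invSq-nonNeg (dist u v)))

  pChoose-rows : RowStochastic (pChoose n) V
  pChoose-rows u = begin
    ∑ V (pChoose n u)                 ≡⟨ ∑-cong V (λ {v} _ → pChoose-invSq u v) ⟩
    ∑ V (λ v → Z * invSq (dist u v))  ≡⟨ sym (*-∑ Z V (invSq ∘ dist u)) ⟩
    Z * invSqSum u                    ≡⟨ Z-*-invSqSum u ⟩
    1ℚ                                ∎
    where open ≡-Reasoning

  pChoose-columns : ∀ (u : Vtx n) → ∑ V (λ w → pChoose n w u) ≡ 1ℚ
  pChoose-columns u = begin
    ∑ V (λ w → pChoose n w u)
      ≡⟨ ∑-cong V (λ {w} _ → trans (pChoose-invSq w u) (cong (λ d → Z * invSq d) (dist-comm w u))) ⟩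
    ∑ V (λ w → Z * invSq (dist u w))  ≡⟨ sym (*-∑ Z V (invSq ∘ dist u)) ⟩
    Z * invSqSum u                    ≡⟨ Z-*-invSqSum u ⟩
    1ℚ                                ∎
    where open ≡-Reasoning

  expected-inDegree : ∀ (u : Vtx n) →
    ∑ (allFuns u V V) (λ f → weight (pChoose n) V f * count (λ w → does (f w ≟V u)) V) ≡ 1ℚ
  expected-inDegree u = begin
    ∑ Fs (λ f → P f * ∑ V (λ w → χ (does (f w ≟V u))))
      ≡⟨ ∑-cong Fs (λ {f} _ → *-∑ (P f) V _) ⟩
    ∑ Fs (λ f → ∑ V (λ w → P f * χ (does (f w ≟V u))))
      ≡⟨ ∑-comm Fs V _ ⟩
    ∑ V (λ w → ∑ Fs (λ f → P f * χ (does (f w ≟V u))))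
      ≡⟨ ∑-cong V (λ {w} w∈V → ∑-weight-marginal {q = pChoose n} {V} pChoose-rows u
           (λ c → χ (does (c ≟V u))) {w} V (allV-unique n) w∈V) ⟩
    ∑ V (λ w → ∑ V (λ c → pChoose n w c * χ (does (c ≟V u))))
      ≡⟨ ∑-cong V (λ {w} _ → ∑-χ-≟ _≟V_ (pChoose n w) (allV-unique n) (∈-allV u)) ⟩
    ∑ V (λ w → pChoose n w u)
      ≡⟨ pChoose-columns u ⟩
    1ℚ ∎
    where
    open ≡-Reasoning
    Fs : List (Vtx n → Vtx n)
    Fs = allFuns u V V
    P : (Vtx n → Vtx n) → ℚ
    P = weight (pChoose n) V

  expDeg≤6 : ∀ (u : Vtx n) → expDeg n u ≤ℚ fromℕ 6
  expDeg≤6 u = begin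
    ∑ Fs (λ f → P f * fromℕ (degG n f u))
      ≤⟨ ∑-mono-≤ Fs (λ {f} _ → *-monoˡ-≤-nonNeg (P f) {{nonNegative (P≥0 f)}} (degree≤ f u)) ⟩
    ∑ Fs (λ f → P f * (fromℕ 5 + inDegree f))
      ≡⟨ ∑-cong Fs (λ {f} _ → *-distribˡ-+ (P f) (fromℕ 5) (inDegree f)) ⟩
    ∑ Fs (λ f → P f * fromℕ 5 + P f * inDegree f)
      ≡⟨ ∑-+ Fs _ _ ⟩
    ∑ Fs (λ f → P f * fromℕ 5) + ∑ Fs (λ f → P f * inDegree f)
      ≡⟨ cong₂ _+_ (sym (∑-* (fromℕ 5) Fs P)) (expected-inDegree u) ⟩
    ∑ Fs P * fromℕ 5 + 1ℚ
      ≡⟨ cong (λ s → s * fromℕ 5 + 1ℚ) (∑-weight {q = pChoose n} pChoose-rows u V (allV-unique n)) ⟩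
    1ℚ * fromℕ 5 + 1ℚ ∎
    where
    open ≤-Reasoning
    Fs : List (Vtx n → Vtx n)
    Fs = allFuns u V V
    P : (Vtx n → Vtx n) → ℚ
    P = weight (pChoose n) V
    P≥0 : ∀ f → 0ℚ ≤ℚ P f
    P≥0 = weight-nonNeg {q = pChoose n} pChoose-nonNeg V
    inDegree : (Vtx n → Vtx n) → ℚ
    inDegree f = count (λ w → does (f w ≟V u)) V

lemma23 : (n : ℕ) → 3 ≤ n → (u : Vtx n) → expDeg n u ≤ℚ ((+ 6) / 1)
lemma23 (suc (suc (suc k))) (s≤s (s≤s (s≤s _))) u = expDeg≤6 u
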